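{- Let $S=(w_1,\ldots,w_{3m})$ be a list of positive integers and $b$ a positive integer. If $\mathcal{P}$ is a path decomposition of $G(S,b)$ of width $4$ and length $l=1-2m+2\sum_{i=1}^{3m}w_i$, then each bag of $\mathcal{P}$ contains exactly one clique of $G(S,b)$.
   Context: A path decomposition of a graph $G$ is a sequence $(X_1,\ldots,X_l)$ of subsets of $V(G)$ such that $\bigcup_i X_i=V(G)$; every edge has both endpoints in some $X_i$; and $X_i\cap X_k\subseteq X_j$ whenever $i\leq j\leq k$; width is $\max_i|X_i|-1$, length is $l$. The graph $G(S,b)$: for each $i\in\{1,\ldots,3m\}$, $H_i$ is obtained from pairwise disjoint cliques $K_3^{i,q}$ ($q=1,\ldots,w_i$, copies of $K_3$) and $K_4^{i,q}$ ($q=1,\ldots,w_i-1$, copies of $K_4$) by identifying, for each $q\leq w_i-1$, two different vertices of $K_4^{i,q}$ with a vertex of $K_3^{i,q}$ and a vertex of $K_3^{i,q+1}$ respectively, such that each vertex of each $K_3^{i,q}$ is identified with at most one vertex of another clique. $H_{m,b}$ is obtained from disjoint copies $K_5^1,\ldots,K_5^{m+1}$ of $K_5$ and disjoint copies $P_b^1,\ldots,P_b^m$ of the path with $b$ edges by identifying one endpoint of $P_b^j$ with a vertex of $K_5^j$ and the other with a vertex of $K_5^{j+1}$, so that no vertex of any $K_5^j$ is identified with endpoints of two different paths. $G(S,b)$ is the disjoint union of $H_1,\ldots,H_{3m},H_{m,b}$. The cliques of $G(S,b)$ are the subgraphs $K_3^{i,q}$, $K_4^{i,q}$, $K_5^j$.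 A bag contains a clique if it contains all of its vertices. -}

module Defs where

open import Data.Nat using (ℕ; zero; suc; _+_; _*_; _≤_; _<_; _≡ᵇ_)
open import Data.Bool using (if_then_else_)
open import Data.List using (List; []; _∷_; length)
open import Data.List.Membership.Propositional using (_∈_)
open import Data.List.Relation.Unary.All using (All)
open import Data.List.Relation.Unary.Unique.Propositional using (Unique)
open import Data.Fin using (Fin)
open import Data.Product using (Σ; _×_; ∃)
open import Relation.Binary.PropositionalEquality using (_≡_)

-- w_i = i-th entry of S (0-indexed); 0 if out of range (never used in range-checked positions)
_!!_ : List ℕ → ℕ → ℕ
[]      !! _     = 0
(x ∷ _) !! zero  = x
(_ ∷ s) !! suc i = s !! i

-- Indices are 0-based.
--  tri  i q a : vertex a (a<3) of K_3^{i,q}          (i < 3m, q < w_i)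
--  quad i q c : the two non-identified vertices c<2 of K_4^{i,q}   (q+1 < w_i)
--  five j a   : vertex a (a<5) of K_5^j               (j ≤ m)
--  path j t   : internal vertex t (0<t<b) of P_b^j    (j < m)
data Vx : Set where
  tri  : ℕ → ℕ → ℕ → Vx
  quad : ℕ → ℕ → ℕ → Vx
  five : ℕ → ℕ → Vx
  path : ℕ → ℕ → Vx

module Graph (m : ℕ) (S : List ℕ) (b : ℕ) where

  Valid : Vx → Set
  Valid (tri i q a)  = i < length S × q < S !! i × a < 3
  Valid (quad i q c) = i < length S × suc q < S !! i × c < 2
  Valid (five j a)   = j ≤ m × a < 5
  Valid (path j t)   = j < m × 1 ≤ t × t < b

  K3 : ℕ → ℕ → List Vx
  K3 i q = tri i q 0 ∷ tri i q 1 ∷ tri i q 2 ∷ []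

  -- K_4^{i,q}: vertex 1 of K_3^{i,q} and vertex 0 of K_3^{i,q+1} are identified
  -- with two distinct vertices of K_4^{i,q}
  K4 : ℕ → ℕ → List Vx
  K4 i q = tri i q 1 ∷ tri i (suc q) 0 ∷ quad i q 0 ∷ quad i q 1 ∷ []

  K5 : ℕ → List Vx
  K5 j = five j 0 ∷ five j 1 ∷ five j 2 ∷ five j 3 ∷ five j 4 ∷ []

  data Clique : List Vx → Set where
    k3 : ∀ {i q} → i < length S → q < S !! i → Clique (K3 i q)
    k4 : ∀ {i q} → i < length S → suc q < S !! i → Clique (K4 i q)
    k5 : ∀ {j} → j ≤ m → Clique (K5 j)

  -- t-th vertex (0 ≤ t ≤ b) of the path P_b^j: endpoint 0 is vertex 0 of K_5^j,
  -- endpoint b is vertex 1 of K_5^{j+1}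
  pv : ℕ → ℕ → Vx
  pv j zero    = five j 0
  pv j (suc t) = if suc t ≡ᵇ b then five (suc j) 1 else path j (suc t)

  data Edge : Vx → Vx → Set where
    cliqueE : ∀ {C u v} → Clique C → u ∈ C → v ∈ C → Edge u v
    pathE   : ∀ {j t} → j < m → t < b → Edge (pv j t) (pv j (suc t))

  record PathDecomposition (l : ℕ) (X : Fin l → List Vx) : Set where
    field
      bagsDistinct : ∀ i → Unique (X i)
      bagsValid    : ∀ i → All Valid (X i)
      cover        : ∀ v → Valid v → ∃ λ i → v ∈ X i
      edgeCover    : ∀ u v → Edge u v → ∃ λ i → u ∈ X i × v ∈ X i
      interpolate  : ∀ (i j k : Fin l) → i Data.Fin.≤ j → j Data.Fin.≤ k →
                     ∀ v → v ∈ X i → v ∈ X k → v ∈ X j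

  HasWidth : (l : ℕ) → (Fin l → List Vx) → ℕ → Set
  HasWidth l X w = (∀ i → length (X i) ≤ suc w) × (∃ λ i → length (X i) ≡ suc w)

  ContainsClique : List Vx → List Vx → Set
  ContainsClique B C = All (_∈ B) C

  ExactlyOneClique : List Vx → Set
  ExactlyOneClique B = Σ (List Vx) λ C → Clique C × ContainsClique B C ×
                         (∀ C' → Clique C' → ContainsClique B C' → C' ≡ C)

module Submission where

-- Every clique of a graph lies in some bag of a path decomposition (Helly property for
-- the intervals of bags containing each vertex), and two distinct cliques of G(S,b)
-- together have at least six vertices, so a bag of size at most 5 contains at most one
-- clique. Hence choosing a bag for each clique is injective. There are
-- (m + 1) + Σᵢ (2 wᵢ − 1) = 1 − 2m + 2 Σᵢ wᵢ = l cliques, so the chosen bags are all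
-- l bags, and every bag contains exactly one clique.

open import Defs
open import Data.Nat using (ℕ; zero; suc; _+_; _*_; _≤_; _<_; _∸_; z≤n; s≤s)
open import Data.Nat.Properties
  using (≤-refl; ≤-trans; ≤-reflexive; ≤-pred; ≤⇒≯; <-irrefl; n≤1+n; _≟_; +-cancelʳ-≡; *-distribˡ-+)
open import Data.Nat.ListAction using (sum)
open import Data.Nat.Tactic.RingSolver using (solve-∀)
open import Data.List using (List; []; _∷_; length; _++_; map; upTo; allFin; drop)
open import Data.List.Properties using (length-++; length-map; length-upTo; length-++-sucʳ; length-tabulate)
open import Data.List.Relation.Unary.All using (All; []; _∷_; reduce)
import Data.List.Relation.Unary.All as All
open import Data.List.Relation.Unary.All.Properties using (All¬⇒¬Any) renaming (++⁺ to All-++⁺)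
open import Data.List.Relation.Unary.Any using (here; there)
open import Data.List.Relation.Unary.AllPairs using ([]; _∷_)
open import Data.List.Relation.Unary.Unique.Propositional using (Unique)
import Data.List.Relation.Unary.Unique.Propositional.Properties as Unique
open import Data.List.Membership.Propositional using (_∈_; _∉_)
open import Data.List.Membership.Propositional.Properties
  using (∈-∃++; ∈-++⁻; ∈-++⁺ˡ; ∈-++⁺ʳ; ∈-map⁻; ∈-upTo⁻; ∈-allFin)
import Data.List.Membership.DecPropositional as DecMembership
open import Data.Fin using (Fin)
import Data.Fin as Fin
import Data.Fin.Properties as Fin
open import Data.Maybe using (Maybe; just; nothing)
open import Data.Maybe.Properties using (just-injective)
open import Data.Product using (Σ; ∃; _×_; _,_)
open import Data.Product.Properties using (≡-dec)
open import Data.Sum using (inj₁; inj₂)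
open import Data.Empty using (⊥; ⊥-elim)
open import Relation.Nullary using (¬_; yes; no)
open import Relation.Binary.PropositionalEquality using (_≡_; _≢_; refl; sym; trans; cong; cong₂; module ≡-Reasoning)

module _ {A : Set} where

  ∈-++-∖ : ∀ {x y : A} xs {ys} → y ∈ xs ++ x ∷ ys → y ≢ x → y ∈ xs ++ ys
  ∈-++-∖ xs p y≢x with ∈-++⁻ xs p
  ... | inj₁ q         = ∈-++⁺ˡ q
  ... | inj₂ (here eq) = ⊥-elim (y≢x eq)
  ... | inj₂ (there q) = ∈-++⁺ʳ xs q

  unique⊆⇒length≤ : ∀ {xs ys : List A} → Unique xs → All (_∈ ys) xs → length xs ≤ length ys
  unique⊆⇒length≤ {[]}     _            _          = z≤n
  unique⊆⇒length≤ {x ∷ xs} (x∉xs ∷ uxs) (x∈ys ∷ xs⊆ys) with ∈-∃++ x∈ys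
  ... | ys₁ , ys₂ , refl = ≤-trans
    (s≤s (unique⊆⇒length≤ uxs (All.zipWith (λ (y∈ , x≢y) → ∈-++-∖ ys₁ y∈ (λ y≡x → x≢y (sym y≡x))) (xs⊆ys , x∉xs))))
    (≤-reflexive (sym (length-++-sucʳ ys₁ x ys₂)))

  disjoint-++-length≤ : ∀ {zs : List A} xs {ys} → Unique zs → Unique xs → Unique ys → All (_∉ ys) xs →
                        All (_∈ zs) xs → All (_∈ zs) ys → length (xs ++ ys) ≤ length zs
  disjoint-++-length≤ xs uzs uxs uys xs∉ys xs⊆zs ys⊆zs =
    unique⊆⇒length≤ (Unique.++⁺ uxs uys (λ (x∈xs , x∈ys) → All.lookup xs∉ys x∈xs x∈ys)) (All-++⁺ xs⊆zs ys⊆zs)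

unique∧n≤length⇒∈ : ∀ {n} {xs : List (Fin n)} → Unique xs → n ≤ length xs → ∀ i → i ∈ xs
unique∧n≤length⇒∈ {n} {xs} uxs n≤ i with DecMembership._∈?_ Fin._≟_ i xs
... | yes i∈xs = i∈xs
... | no  i∉xs = ⊥-elim (≤⇒≯ n≤ (≤-trans i∷xs≤ (≤-reflexive (length-tabulate (λ j → j)))))
  where
  i∷xs≤ : suc (length xs) ≤ length (allFin n)
  i∷xs≤ = unique⊆⇒length≤ (All.tabulate (λ { j∈xs refl → i∉xs j∈xs }) ∷ uxs) (All.universal ∈-allFin (i ∷ xs))

drop-∷ : ∀ i (xs : List ℕ) {y ys} → drop i xs ≡ y ∷ ys → i < length xs × xs !! i ≡ y × drop (suc i) xs ≡ ys
drop-∷ zero    (x ∷ xs) refl = s≤s z≤n , refl , refl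
drop-∷ (suc i) (x ∷ xs) eq with drop-∷ i xs eq
... | i< , xs!!i≡y , drop≡ = s≤s i< , xs!!i≡y , drop≡

module _ {A B : Set} {P : A → Set} (f : ∀ {x} → P x → B) where

  length-reduce : ∀ {xs} (pxs : All P xs) → length (reduce f pxs) ≡ length xs
  length-reduce []         = refl
  length-reduce (_ ∷ pxs) = cong suc (length-reduce pxs)

  ∈-reduce⁻ : ∀ {xs y} (pxs : All P xs) → y ∈ reduce f pxs → ∃ λ x → x ∈ xs × Σ (P x) λ px → y ≡ f px
  ∈-reduce⁻ (px ∷ _)   (here y≡)  = _ , here refl , px , y≡
  ∈-reduce⁻ (_ ∷ pxs) (there y∈) with ∈-reduce⁻ pxs y∈
  ... | x , x∈ , px , y≡ = x , there x∈ , px , y≡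

  Injective : Set
  Injective = ∀ {x y} (px : P x) (py : P y) → f px ≡ f py → x ≡ y

  reduce⁺ : Injective → ∀ {xs} → Unique xs → (pxs : All P xs) → Unique (reduce f pxs)
  reduce⁺ inj []           []         = []
  reduce⁺ inj (x∉xs ∷ uxs) (px ∷ pxs) = All.tabulate fx∉ ∷ reduce⁺ inj uxs pxs
    where
    fx∉ : ∀ {y} → y ∈ reduce f pxs → f px ≢ y
    fx∉ y∈ fx≡y with ∈-reduce⁻ pxs y∈
    ... | x′ , x′∈ , px′ , refl = All.lookup x∉xs x′∈ (inj px px′ fx≡y)

reduce-surjective : ∀ {A : Set} {P : A → Set} {n} (f : ∀ {x} → P x → Fin n) → Injective f →
                    ∀ {xs} → Unique xs → n ≤ length xs → (pxs : All P xs) →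
                    ∀ i → ∃ λ x → Σ (P x) λ px → i ≡ f px
reduce-surjective f inj uxs n≤ pxs i
  with ∈-reduce⁻ f pxs (unique∧n≤length⇒∈ (reduce⁺ f inj uxs pxs) (≤-trans n≤ (≤-reflexive (sym (length-reduce f pxs)))) i)
... | x , _ , px , i≡ = x , px , i≡

module Helly {V : Set} {l : ℕ} (X : Fin l → List V)
  (interpolate : ∀ (i j k : Fin l) → i Fin.≤ j → j Fin.≤ k → ∀ v → v ∈ X i → v ∈ X k → v ∈ X j) where

  infix 4 _∩_⊆_
  _∩_⊆_ : Fin l → Fin l → Fin l → Set
  p ∩ q ⊆ t = ∀ {v} → v ∈ X p → v ∈ X q → v ∈ X t

  ∩-⊆ˡ : ∀ p q → p ∩ q ⊆ p
  ∩-⊆ˡ p q v∈p _ = v∈p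

  ∩-⊆ʳ : ∀ p q → p ∩ q ⊆ q
  ∩-⊆ʳ p q _ v∈q = v∈q

  ∩-⊆-between : ∀ {p t r} → p Fin.≤ t → t Fin.≤ r → p ∩ r ⊆ t
  ∩-⊆-between {p} {t} {r} p≤t t≤r {v} = interpolate p t r p≤t t≤r v

  ∩-⊆-between′ : ∀ {p t r} → r Fin.≤ t → t Fin.≤ p → p ∩ r ⊆ t
  ∩-⊆-between′ r≤t t≤p v∈p v∈r = ∩-⊆-between r≤t t≤p v∈r v∈p

  median : ∀ p q r → ∃ λ t → p ∩ q ⊆ t × q ∩ r ⊆ t × p ∩ r ⊆ t
  median p q r with Fin.≤-total p q | Fin.≤-total q r | Fin.≤-total p r
  ... | inj₁ p≤q | inj₁ q≤r | _        = q , ∩-⊆ʳ p q , ∩-⊆ˡ q r , ∩-⊆-between p≤q q≤r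
  ... | inj₁ p≤q | inj₂ r≤q | inj₁ p≤r = r , ∩-⊆-between p≤r r≤q , ∩-⊆ʳ q r , ∩-⊆ʳ p r
  ... | inj₁ p≤q | inj₂ r≤q | inj₂ r≤p = p , ∩-⊆ˡ p q , ∩-⊆-between′ r≤p p≤q , ∩-⊆ˡ p r
  ... | inj₂ q≤p | _        | inj₁ p≤r = p , ∩-⊆ˡ p q , ∩-⊆-between q≤p p≤r , ∩-⊆ˡ p r
  ... | inj₂ q≤p | inj₁ q≤r | inj₂ r≤p = r , ∩-⊆-between′ q≤r r≤p , ∩-⊆ʳ q r , ∩-⊆ʳ p r
  ... | inj₂ q≤p | inj₂ r≤q | inj₂ _   = q , ∩-⊆ʳ p q , ∩-⊆ˡ q r , ∩-⊆-between′ r≤q q≤p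

  InBag : List V → Set
  InBag C = ∃ λ j → All (_∈ X j) C

  PairwiseInBags : List V → Set
  PairwiseInBags C = ∀ {u w} → u ∈ C → w ∈ C → InBag (u ∷ w ∷ [])

  -- The bag for v ∷ a ∷ A is the median of a bag for v ∷ A, one for v ∷ a and one for a ∷ A.
  ∷-inBag : ∀ {v} A → InBag A → All (λ a → InBag (v ∷ a ∷ [])) A → InBag (v ∷ []) → InBag (v ∷ A)
  ∷-inBag []      _                  _                           v∈ = v∈
  ∷-inBag (a ∷ A) (j , a∈j ∷ A⊆j) ((k , v∈k ∷ a∈k ∷ []) ∷ vA) v∈
    with ∷-inBag A (j , A⊆j) vA v∈
  ... | k′ , v∈k′ ∷ A⊆k′ with median k′ k j
  ... | t , k′k⊆t , kj⊆t , k′j⊆t = t , k′k⊆t v∈k′ v∈k ∷ kj⊆t a∈k a∈j ∷ All.zipWith (λ (x∈k′ , x∈j) → k′j⊆t x∈k′ x∈j) (A⊆k′ , A⊆j)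

  helly : ∀ v C → PairwiseInBags (v ∷ C) → InBag (v ∷ C)
  helly v []      pairs with pairs (here refl) (here refl)
  ... | j , v∈j ∷ _ = j , v∈j ∷ []
  helly v (u ∷ C) pairs with pairs (here refl) (here refl)
  ... | j , v∈j ∷ _ = ∷-inBag (u ∷ C) (helly u C (λ x∈ y∈ → pairs (there x∈) (there y∈)))
                              (All.tabulate (λ a∈ → pairs (here refl) (there a∈))) (j , v∈j ∷ [])

module Cliques (m : ℕ) (S : List ℕ) (b : ℕ) where
  open Graph m S b

  tri-≢ : ∀ {i q a i′ q′ a′} → (i , q) ≢ (i′ , q′) → tri i q a ≢ tri i′ q′ a′
  tri-≢ ne refl = ne refl

  quad-≢ : ∀ {i q c i′ q′ c′} → (i , q) ≢ (i′ , q′) → quad i q c ≢ quad i′ q′ c′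
  quad-≢ ne refl = ne refl

  five-≢ : ∀ {j a j′ a′} → j ≢ j′ → five j a ≢ five j′ a′
  five-≢ ne refl = ne refl

  K3-unique : ∀ i q → Unique (K3 i q)
  K3-unique i q = ((λ ()) ∷ (λ ()) ∷ []) ∷ ((λ ()) ∷ []) ∷ [] ∷ []

  K4-unique : ∀ i q → Unique (K4 i q)
  K4-unique i q = ((λ ()) ∷ (λ ()) ∷ (λ ()) ∷ []) ∷ ((λ ()) ∷ (λ ()) ∷ []) ∷ ((λ ()) ∷ []) ∷ [] ∷ []

  K5-unique : ∀ j → Unique (K5 j)
  K5-unique j = ((λ ()) ∷ (λ ()) ∷ (λ ()) ∷ (λ ()) ∷ []) ∷ ((λ ()) ∷ (λ ()) ∷ (λ ()) ∷ []) ∷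
                ((λ ()) ∷ (λ ()) ∷ []) ∷ ((λ ()) ∷ []) ∷ [] ∷ []

  pair-unique : ∀ {x y : Vx} → x ≢ y → Unique (x ∷ y ∷ [])
  pair-unique x≢y = (x≢y ∷ []) ∷ [] ∷ []

  tri∉K5 : ∀ {i q a j} → tri i q a ∉ K5 j
  tri∉K5 = All¬⇒¬Any ((λ ()) ∷ (λ ()) ∷ (λ ()) ∷ (λ ()) ∷ (λ ()) ∷ [])

  tri2∉K4 : ∀ {i q i′ q′} → tri i q 2 ∉ K4 i′ q′
  tri2∉K4 = All¬⇒¬Any ((λ ()) ∷ (λ ()) ∷ (λ ()) ∷ (λ ()) ∷ [])

  tri∉K3 : ∀ {i q a i′ q′} → (i , q) ≢ (i′ , q′) → tri i q a ∉ K3 i′ q′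
  tri∉K3 ne = All¬⇒¬Any (tri-≢ ne ∷ tri-≢ ne ∷ tri-≢ ne ∷ [])

  tri∉K4 : ∀ {i q a i′ q′} → (i , q) ≢ (i′ , q′) → a ≢ 0 → tri i q a ∉ K4 i′ q′
  tri∉K4 ne a≢0 = All¬⇒¬Any (tri-≢ ne ∷ (λ { refl → a≢0 refl }) ∷ (λ ()) ∷ (λ ()) ∷ [])

  quad∉K4 : ∀ {i q c i′ q′} → (i , q) ≢ (i′ , q′) → quad i q c ∉ K4 i′ q′
  quad∉K4 ne = All¬⇒¬Any ((λ ()) ∷ (λ ()) ∷ quad-≢ ne ∷ quad-≢ ne ∷ [])

  five∉K5 : ∀ {j a j′} → j ≢ j′ → five j a ∉ K5 j′
  five∉K5 ne = All¬⇒¬Any (five-≢ ne ∷ five-≢ ne ∷ five-≢ ne ∷ five-≢ ne ∷ five-≢ ne ∷ [])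

  module SmallBag {B : List Vx} (uB : Unique B) (lB : length B ≤ 5) where

    overfull : ¬ (6 ≤ length B)
    overfull = ≤⇒≯ lB

    K3-K4-not-both : ∀ {i q i′ q′} → All (_∈ B) (K3 i q) → All (_∈ B) (K4 i′ q′) → ⊥
    K3-K4-not-both {i} {q} {i′} {q′} (a0 ∷ a1 ∷ a2 ∷ []) K4⊆B with ≡-dec _≟_ _≟_ (i , q) (i′ , q′)
    ... | yes refl = overfull (disjoint-++-length≤ (tri i q 0 ∷ tri i q 2 ∷ []) uB (pair-unique (λ ())) (K4-unique i q)
                       (All¬⇒¬Any ((λ ()) ∷ (λ ()) ∷ (λ ()) ∷ (λ ()) ∷ []) ∷ tri2∉K4 ∷ []) (a0 ∷ a2 ∷ []) K4⊆B)
    ... | no ne    = overfull (disjoint-++-length≤ (tri i q 1 ∷ tri i q 2 ∷ []) uB (pair-unique (λ ())) (K4-unique i′ q′)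
                       (tri∉K4 ne (λ ()) ∷ tri2∉K4 ∷ []) (a1 ∷ a2 ∷ []) K4⊆B)

    K5-alone : ∀ {j y} → y ∉ K5 j → y ∈ B → All (_∈ B) (K5 j) → ⊥
    K5-alone {j} {y} y∉ y∈ K5⊆B = overfull (disjoint-++-length≤ (y ∷ []) uB ([] ∷ []) (K5-unique j) (y∉ ∷ []) (y∈ ∷ []) K5⊆B)

    clique-unique : ∀ {C C′} → Clique C → Clique C′ → All (_∈ B) C → All (_∈ B) C′ → C′ ≡ C
    clique-unique (k3 {i} {q} _ _) (k3 {i′} {q′} _ _) C⊆B C′⊆B with ≡-dec _≟_ _≟_ (i′ , q′) (i , q)
    ... | yes refl = refl
    ... | no ne    = ⊥-elim (overfull (disjoint-++-length≤ (K3 i′ q′) uB (K3-unique i′ q′) (K3-unique i q)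
                       (tri∉K3 ne ∷ tri∉K3 ne ∷ tri∉K3 ne ∷ []) C′⊆B C⊆B))
    clique-unique (k3 _ _) (k4 _ _) C⊆B C′⊆B = ⊥-elim (K3-K4-not-both C⊆B C′⊆B)
    clique-unique (k4 _ _) (k3 _ _) C⊆B C′⊆B = ⊥-elim (K3-K4-not-both C′⊆B C⊆B)
    clique-unique (k4 {i} {q} _ _) (k4 {i′} {q′} _ _) C⊆B (_ ∷ _ ∷ c0 ∷ c1 ∷ []) with ≡-dec _≟_ _≟_ (i′ , q′) (i , q)
    ... | yes refl = refl
    ... | no ne    = ⊥-elim (overfull (disjoint-++-length≤ (quad i′ q′ 0 ∷ quad i′ q′ 1 ∷ []) uB (pair-unique (λ ()))
                       (K4-unique i q) (quad∉K4 ne ∷ quad∉K4 ne ∷ []) (c0 ∷ c1 ∷ []) C⊆B))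
    clique-unique (k3 _ _) (k5 _) (t∈ ∷ _) C′⊆B = ⊥-elim (K5-alone tri∉K5 t∈ C′⊆B)
    clique-unique (k4 _ _) (k5 _) (t∈ ∷ _) C′⊆B = ⊥-elim (K5-alone tri∉K5 t∈ C′⊆B)
    clique-unique (k5 _) (k3 _ _) C⊆B (t∈ ∷ _)  = ⊥-elim (K5-alone tri∉K5 t∈ C⊆B)
    clique-unique (k5 _) (k4 _ _) C⊆B (t∈ ∷ _)  = ⊥-elim (K5-alone tri∉K5 t∈ C⊆B)
    clique-unique (k5 {j} _) (k5 {j′} _) C⊆B (f∈ ∷ _) with j′ ≟ j
    ... | yes refl = refl
    ... | no ne    = ⊥-elim (K5-alone (five∉K5 ne) f∈ C⊆B)

  rowCliques : ℕ → ℕ → List (List Vx)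
  rowCliques i w = map (K3 i) (upTo w) ++ map (K4 i) (upTo (w ∸ 1))

  rowsFrom : ℕ → List ℕ → List (List Vx)
  rowsFrom i []       = []
  rowsFrom i (w ∷ ws) = rowCliques i w ++ rowsFrom (suc i) ws

  cliques : List (List Vx)
  cliques = map K5 (upTo (suc m)) ++ rowsFrom 0 S

  rowsFrom-clique : ∀ i ws → drop i S ≡ ws → All Clique (rowsFrom i ws)
  rowsFrom-clique i []       _  = []
  rowsFrom-clique i (w ∷ ws) eq with drop-∷ i S eq
  ... | i< , refl , drop≡ = All-++⁺ (All-++⁺ (All.tabulate K3-clique) (All.tabulate K4-clique)) (rowsFrom-clique (suc i) ws drop≡)
    where
    K3-clique : ∀ {C} → C ∈ map (K3 i) (upTo w) → Clique C
    K3-clique C∈ with ∈-map⁻ (K3 i) C∈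
    ... | q , q∈ , refl = k3 i< (∈-upTo⁻ q∈)
    K4-clique : ∀ {C} → C ∈ map (K4 i) (upTo (w ∸ 1)) → Clique C
    K4-clique C∈ with ∈-map⁻ (K4 i) C∈
    ... | q , q∈ , refl = k4 i< (m<n∸1⇒1+m<n (∈-upTo⁻ q∈))
      where
      m<n∸1⇒1+m<n : ∀ {q n} → q < n ∸ 1 → suc q < n
      m<n∸1⇒1+m<n {n = suc n} q< = s≤s q<

  cliques-clique : All Clique cliques
  cliques-clique = All-++⁺ (All.tabulate K5-clique) (rowsFrom-clique 0 S refl)
    where
    K5-clique : ∀ {C} → C ∈ map K5 (upTo (suc m)) → Clique C
    K5-clique C∈ with ∈-map⁻ K5 C∈
    ... | j , j∈ , refl = k5 (≤-pred (∈-upTo⁻ j∈))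

  rowOf : List Vx → Maybe ℕ
  rowOf (tri i _ _ ∷ _) = just i
  rowOf _               = nothing

  rowOf-rowCliques : ∀ {C} i w → C ∈ rowCliques i w → rowOf C ≡ just i
  rowOf-rowCliques i w C∈ with ∈-++⁻ (map (K3 i) (upTo w)) C∈
  ... | inj₁ C∈K3s with ∈-map⁻ (K3 i) C∈K3s
  ...   | _ , _ , refl = refl
  rowOf-rowCliques i w C∈ | inj₂ C∈K4s with ∈-map⁻ (K4 i) C∈K4s
  ...   | _ , _ , refl = refl

  rowOf-rowsFrom : ∀ {C} i ws → C ∈ rowsFrom i ws → ∃ λ i′ → i ≤ i′ × rowOf C ≡ just i′
  rowOf-rowsFrom i (w ∷ ws) C∈ with ∈-++⁻ (rowCliques i w) C∈
  ... | inj₁ C∈row  = i , ≤-refl , rowOf-rowCliques i w C∈row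
  ... | inj₂ C∈rows with rowOf-rowsFrom (suc i) ws C∈rows
  ...   | i′ , i<i′ , rowOf≡ = i′ , ≤-trans (n≤1+n i) i<i′ , rowOf≡

  rowCliques-unique : ∀ i w → Unique (rowCliques i w)
  rowCliques-unique i w = Unique.++⁺ (Unique.map⁺ (λ { refl → refl }) (Unique.upTo⁺ w))
                                      (Unique.map⁺ (λ { refl → refl }) (Unique.upTo⁺ (w ∸ 1))) K3s∩K4s
    where
    K3s∩K4s : ∀ {C} → ¬ (C ∈ map (K3 i) (upTo w) × C ∈ map (K4 i) (upTo (w ∸ 1)))
    K3s∩K4s (C∈K3s , C∈K4s) with ∈-map⁻ (K3 i) C∈K3s | ∈-map⁻ (K4 i) C∈K4s
    ... | _ , _ , refl | _ , _ , ()

  rowsFrom-unique : ∀ i ws → Unique (rowsFrom i ws)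
  rowsFrom-unique i []       = []
  rowsFrom-unique i (w ∷ ws) = Unique.++⁺ (rowCliques-unique i w) (rowsFrom-unique (suc i) ws) row∩rows
    where
    row∩rows : ∀ {C} → ¬ (C ∈ rowCliques i w × C ∈ rowsFrom (suc i) ws)
    row∩rows (C∈row , C∈rows) with rowOf-rowCliques i w C∈row | rowOf-rowsFrom (suc i) ws C∈rows
    ... | rowOf≡i | _ , i<i′ , rowOf≡i′ = <-irrefl (just-injective (trans (sym rowOf≡i) rowOf≡i′)) i<i′

  cliques-unique : Unique cliques
  cliques-unique = Unique.++⁺ (Unique.map⁺ (λ { refl → refl }) (Unique.upTo⁺ (suc m))) (rowsFrom-unique 0 S) K5s∩rows
    where
    K5s∩rows : ∀ {C} → ¬ (C ∈ map K5 (upTo (suc m)) × C ∈ rowsFrom 0 S)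
    K5s∩rows (C∈K5s , C∈rows) with ∈-map⁻ K5 C∈K5s | rowOf-rowsFrom 0 S C∈rows
    ... | _ , _ , refl | _ , _ , ()

  length-rowCliques : ∀ i w → length (rowCliques i w) ≡ w + (w ∸ 1)
  length-rowCliques i w = begin
    length (map (K3 i) (upTo w) ++ map (K4 i) (upTo (w ∸ 1)))          ≡⟨ length-++ (map (K3 i) (upTo w)) ⟩
    length (map (K3 i) (upTo w)) + length (map (K4 i) (upTo (w ∸ 1)))  ≡⟨ cong₂ _+_ (length-map (K3 i) (upTo w)) (length-map (K4 i) (upTo (w ∸ 1))) ⟩
    length (upTo w) + length (upTo (w ∸ 1))                             ≡⟨ cong₂ _+_ (length-upTo w) (length-upTo (w ∸ 1)) ⟩
    w + (w ∸ 1)                                                         ∎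
    where open ≡-Reasoning

  length-rowsFrom : ∀ i ws → All (1 ≤_) ws → length (rowsFrom i ws) + length ws ≡ 2 * sum ws
  length-rowsFrom i []           []          = refl
  length-rowsFrom i (suc w ∷ ws) (_ ∷ ws≥1) = begin
    length (rowCliques i (suc w) ++ rowsFrom (suc i) ws) + suc (length ws)
      ≡⟨ cong (_+ suc (length ws)) (length-++ (rowCliques i (suc w))) ⟩
    (length (rowCliques i (suc w)) + length (rowsFrom (suc i) ws)) + suc (length ws)
      ≡⟨ cong (λ r → (r + length (rowsFrom (suc i) ws)) + suc (length ws)) (length-rowCliques i (suc w)) ⟩
    (suc w + w + length (rowsFrom (suc i) ws)) + suc (length ws)
      ≡⟨ regroup w (length (rowsFrom (suc i) ws)) (length ws) ⟩
    2 * suc w + (length (rowsFrom (suc i) ws) + length ws)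
      ≡⟨ cong (2 * suc w +_) (length-rowsFrom (suc i) ws ws≥1) ⟩
    2 * suc w + 2 * sum ws
      ≡⟨ *-distribˡ-+ 2 (suc w) (sum ws) ⟨
    2 * sum (suc w ∷ ws) ∎
    where
    open ≡-Reasoning
    regroup : ∀ w r n → (suc w + w + r) + suc n ≡ 2 * suc w + (r + n)
    regroup = solve-∀

  length-cliques : length S ≡ 3 * m → All (1 ≤_) S → length cliques + 2 * m ≡ 1 + 2 * sum S
  length-cliques lenS S≥1 = begin
    length (map K5 (upTo (suc m)) ++ rowsFrom 0 S) + 2 * m
      ≡⟨ cong (_+ 2 * m) (length-++ (map K5 (upTo (suc m)))) ⟩
    (length (map K5 (upTo (suc m))) + length (rowsFrom 0 S)) + 2 * m
      ≡⟨ cong (λ k → (k + length (rowsFrom 0 S)) + 2 * m) (trans (length-map K5 (upTo (suc m))) (length-upTo (suc m))) ⟩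
    (suc m + length (rowsFrom 0 S)) + 2 * m
      ≡⟨ regroup m (length (rowsFrom 0 S)) ⟩
    1 + (length (rowsFrom 0 S) + 3 * m)
      ≡⟨ cong (λ n → 1 + (length (rowsFrom 0 S) + n)) lenS ⟨
    1 + (length (rowsFrom 0 S) + length S)
      ≡⟨ cong (1 +_) (length-rowsFrom 0 S S≥1) ⟩
    1 + 2 * sum S ∎
    where
    open ≡-Reasoning
    regroup : ∀ m r → (suc m + r) + 2 * m ≡ 1 + (r + 3 * m)
    regroup = solve-∀

module Decomposition {m S b l X} (pd : Graph.PathDecomposition m S b l X) (bags≤5 : ∀ i → length (X i) ≤ 5) where
  open Graph m S b
  open PathDecomposition pd
  open Helly X interpolate
  open Cliques m S b

  clique-inBag : ∀ {C} → Clique C → InBag C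
  clique-inBag {[]}    ()
  clique-inBag {v ∷ C} c = helly v C edges-inBags
    where
    edges-inBags : PairwiseInBags (v ∷ C)
    edges-inBags u∈ w∈ with edgeCover _ _ (cliqueE c u∈ w∈)
    ... | j , u∈j , w∈j = j , u∈j ∷ w∈j ∷ []

  atMostOneClique : ∀ {C C′} j → Clique C → Clique C′ → All (_∈ X j) C → All (_∈ X j) C′ → C′ ≡ C
  atMostOneClique j = SmallBag.clique-unique (bagsDistinct j) (bags≤5 j)

  PlacedClique : List Vx → Set
  PlacedClique C = Clique C × InBag C

  bagOf : ∀ {C} → PlacedClique C → Fin l
  bagOf (_ , j , _) = j

  bagOf-injective : Injective {P = PlacedClique} bagOf
  bagOf-injective (c , j , C⊆j) (c′ , .j , C′⊆j) refl = sym (atMostOneClique j c c′ C⊆j C′⊆j)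

  cliques-placed : All PlacedClique cliques
  cliques-placed = All.map (λ c → c , clique-inBag c) cliques-clique

  exactlyOneClique : l ≤ length cliques → ∀ i → ExactlyOneClique (X i)
  exactlyOneClique l≤ i = fromPlaced (reduce-surjective bagOf bagOf-injective cliques-unique l≤ cliques-placed i)
    where
    fromPlaced : (∃ λ C → Σ (PlacedClique C) λ p → i ≡ bagOf p) → ExactlyOneClique (X i)
    fromPlaced (C , (c , j , C⊆j) , refl) = C , c , C⊆j , λ C′ c′ C′⊆j → atMostOneClique j c c′ C⊆j C′⊆j

lemma5 : (m : ℕ) (S : List ℕ) (b : ℕ) →
    length S ≡ 3 * m → All (λ w → 1 ≤ w) S → 1 ≤ b →
    (l : ℕ) (X : Fin l → List Vx) →
    Graph.PathDecomposition m S b l X → Graph.HasWidth m S b l X 4 →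
    l + 2 * m ≡ 1 + 2 * sum S →
    ∀ i → Graph.ExactlyOneClique m S b (X i)
lemma5 m S b lenS S≥1 _ l X pd (bags≤5 , _) lenl =
  Decomposition.exactlyOneClique pd bags≤5 (≤-reflexive l≡#cliques)
  where
  open Cliques m S b using (cliques; length-cliques)
  l≡#cliques : l ≡ length cliques
  l≡#cliques = +-cancelʳ-≡ (2 * m) l (length cliques) (trans lenl (sym (length-cliques lenS S≥1)))
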